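{- For every odd integer $n\ge 3$ and every positive divisor $\lambda$ of $n$ there exists a ${}^{\lambda}\mathrm{H}_{n/\lambda}(n;3)$.
   Context: A partially filled (p.f.) array is a matrix in which some cells may be empty. For positive integers $\lambda,\tau$ with $\tau$ dividing $\frac{6n}{\lambda}$, put $w=\frac{6n}{\lambda}+\tau$ and let $J$ be the subgroup of $\mathbb{Z}_w$ of order $\tau$. ${}^{\lambda}\mathrm{H}_\tau(n;3)$ denotes an $n\times n$ p.f. array with entries in $\mathbb{Z}_w$ such that: (a) each row and each column has exactly $3$ filled cells; (b) the multiset $\{\pm x : x \text{ an entry of a filled cell}\}$ (with multiplicity) contains each element of $\mathbb{Z}_w\setminus J$ exactly $\lambda$ times; (c) every row and column sums to $0$ in $\mathbb{Z}_w$. -}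

module Defs where

open import Data.Nat using (ℕ; zero; suc; _+_; _*_; NonZero)
open import Data.Nat.DivMod using (_/_)
open import Data.Nat.Divisibility using (_∣_; _∣?_)
open import Data.Fin using (Fin; toℕ)
open import Data.Fin.Properties using () renaming (_≟_ to _≟ᶠ_)
open import Data.List using (List; map)
open import Data.Nat.ListAction using (sum)
open import Data.List.Base using (allFin)
open import Data.Empty using (⊥)
open import Data.Product using (Σ)
open import Data.Maybe using (Maybe; just; nothing)
open import Relation.Nullary.Decidable using (Dec; yes; no)
open import Relation.Binary.PropositionalEquality using (_≡_)

[_] : {P : Set} → Dec P → ℕ
[ yes _ ] = 1
[ no _ ]  = 0

Σ[<_]_ : (n : ℕ) → (Fin n → ℕ) → ℕ
Σ[< n ] f = sum (map f (allFin n))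

-- A p.f. n×n array with entries in ℤ_w : a cell is either empty (nothing)
-- or filled with an element of ℤ_w, represented by Fin w.
PFArray : ℕ → ℕ → Set
PFArray n w = Fin n → Fin n → Maybe (Fin w)

filled : {w : ℕ} → Maybe (Fin w) → ℕ
filled nothing  = 0
filled (just _) = 1

val : {w : ℕ} → Maybe (Fin w) → ℕ
val nothing  = 0
val (just e) = toℕ e

-- multiplicity with which x occurs in {e, -e} (as a multiset) for a filled
-- cell e; 0 for empty cells.  In ℤ_w, x = -e iff w ∣ e + x.
pmCount : {w : ℕ} → Fin w → Maybe (Fin w) → ℕ
pmCount x nothing  = 0
pmCount {w} x (just e) = [ e ≟ᶠ x ] + [ w ∣? (toℕ e + toℕ x) ]

-- Membership in J, the subgroup of ℤ_w of order τ (τ ∣ w): the unique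
-- subgroup of order τ of the cyclic group ℤ_w is {x : τ·x = 0 in ℤ_w}.
InJ : (w τ : ℕ) → Fin w → Set
InJ w τ x = w ∣ (τ * toℕ x)

modulus : (lam τ n : ℕ) → .{{NonZero lam}} → ℕ
modulus lam τ n = (6 * n) / lam + τ

record IsH (lam τ n w : ℕ) (A : PFArray n w) : Set where
  field
    rowFilled : ∀ i → Σ[< n ] (λ j → filled (A i j)) ≡ 3
    colFilled : ∀ j → Σ[< n ] (λ i → filled (A i j)) ≡ 3
    -- (b) the multiset {±x : x entry of a filled cell} is λ·(ℤ_w ∖ J):
    --     elements outside J appear exactly λ times, elements of J not at all
    multOutJ : ∀ x → (InJ w τ x → ⊥) → Σ[< n ] (λ i → Σ[< n ] (λ j → pmCount x (A i j))) ≡ lam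
    multInJ  : ∀ x → InJ w τ x → Σ[< n ] (λ i → Σ[< n ] (λ j → pmCount x (A i j))) ≡ 0
    rowSum : ∀ i → w ∣ Σ[< n ] (λ j → val (A i j))
    colSum : ∀ j → w ∣ Σ[< n ] (λ i → val (A i j))

HArray : (lam τ n : ℕ) → .{{NonZero lam}} → Set
HArray lam τ n = Σ (PFArray n (modulus lam τ n)) (IsH lam τ n (modulus lam τ n))

-- Write n = λτ with τ = 2h + 1 odd, so w = 7τ and J = 7ℤ_w. Row i of the array, of class
-- t = i mod τ, holds 7t + 1, 7t + 2 and 7(τ − 1 − (2t mod τ)) + 4 in columns i, i + 2 and
-- i + 1 (mod n). The three entries add up to 7(2t + τ − (2t mod τ)) ≡ 0 (mod 7τ), and column j
-- meets rows j, j − 2, j − 1, whose classes satisfy j + (j − 2) ≡ 2(j − 1) (mod τ), so the same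
-- computation applies. As t runs over ℤ_τ the entries and their negatives run through the
-- residue classes ±1, ±2, ±4 modulo 7 exactly once each: for ±4 because doubling is a
-- bijection of ℤ_τ when τ is odd. Each class t occurs in λ rows, so every element of ℤ_w ∖ J
-- is hit exactly λ times.
module Submission where

open import Defs
open import Data.Nat using (ℕ; _≤_; NonZero)
open import Data.Nat.DivMod using (_/_)
open import Data.Nat.Divisibility using (_∣_)
open import Relation.Nullary using (¬_)

open import Data.Nat.Base using (zero; suc; _+_; _*_; _∸_; _<_; s≤s; s≤s⁻¹; z<s; _%_)
open import Data.Nat.Properties
open import Data.Nat.DivMod
  using (m≡m%n+[m/n]*n; [m+n]%n≡m%n; [m+kn]%n≡m%n; m%n<n; m<n⇒m%n≡m; m%n%n≡m%n; %-distribˡ-+;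
         %-distribˡ-*; m*n/n≡m; m<n*o⇒m/o<n)
open import Data.Nat.Divisibility
  using (divides; _∣?_; _∣0; ∣-refl; m%n≡0⇒n∣m; n∣m⇒m%n≡0; *-cancelˡ-∣; *-monoʳ-∣; ∣m⇒∣m*n; ∣m∣n⇒∣m+n)
open import Data.Nat.Tactic.RingSolver using (solve-∀)
open import Data.Fin.Base using (Fin; toℕ; fromℕ<)
import Data.Fin.Base as Fin
open import Data.Fin.Properties using (toℕ-fromℕ<; toℕ-injective; toℕ<n) renaming (_≟_ to _≟ᶠ_)
open import Data.List.Base using (map; allFin; tabulate)
open import Data.List.Properties using (map-tabulate)
open import Data.Nat.ListAction using (sum)
open import Data.Maybe.Base using (Maybe; just; nothing)
open import Data.Product.Base using (Σ; _×_; _,_)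
open import Data.Empty using (⊥-elim)
open import Relation.Nullary.Decidable using (Dec; yes; no)
open import Relation.Binary.PropositionalEquality using (_≡_; _≢_; refl; sym; trans; cong; cong₂; subst; subst₂; module ≡-Reasoning)

open ≡-Reasoning

[]-yes : {P : Set} (P? : Dec P) → P → [ P? ] ≡ 1
[]-yes (yes _) _ = refl
[]-yes (no ¬p) p = ⊥-elim (¬p p)

[]-no : {P : Set} (P? : Dec P) → ¬ P → [ P? ] ≡ 0
[]-no (yes p) ¬p = ⊥-elim (¬p p)
[]-no (no _)  _  = refl

[]-cong : {P Q : Set} (P? : Dec P) (Q? : Dec Q) → (P → Q) → (Q → P) → [ P? ] ≡ [ Q? ]
[]-cong (yes p) Q? to _    = sym ([]-yes Q? (to p))
[]-cong (no ¬p) Q? _  from = sym ([]-no Q? (λ q → ¬p (from q)))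

sumBelow : ℕ → (ℕ → ℕ) → ℕ
sumBelow zero    f = 0
sumBelow (suc n) f = f 0 + sumBelow n (λ k → f (suc k))

Σ[<]-toℕ : ∀ n (f : ℕ → ℕ) → Σ[< n ] (λ i → f (toℕ i)) ≡ sumBelow n f
Σ[<]-toℕ zero    f = refl
Σ[<]-toℕ (suc n) f = cong (f 0 +_) (begin
  sum (map f∘toℕ (tabulate {n = n} Fin.suc))     ≡⟨ cong sum (map-tabulate {n = n} Fin.suc f∘toℕ) ⟩
  sum (tabulate {n = n} (λ i → f (suc (toℕ i)))) ≡⟨ cong sum (map-tabulate {n = n} (λ i → i) (λ i → f (suc (toℕ i)))) ⟨
  sum (map (λ i → f (suc (toℕ i))) (allFin n))   ≡⟨ Σ[<]-toℕ n (λ k → f (suc k)) ⟩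
  sumBelow n (λ k → f (suc k))                   ∎)
  where
  f∘toℕ : Fin (suc n) → ℕ
  f∘toℕ i = f (toℕ i)

sumBelow-cong : ∀ n {f g : ℕ → ℕ} → (∀ k → k < n → f k ≡ g k) → sumBelow n f ≡ sumBelow n g
sumBelow-cong zero    eq = refl
sumBelow-cong (suc n) eq = cong₂ _+_ (eq 0 z<s) (sumBelow-cong n (λ k k<n → eq (suc k) (s≤s k<n)))

sumBelow-0 : ∀ n → sumBelow n (λ _ → 0) ≡ 0
sumBelow-0 zero    = refl
sumBelow-0 (suc n) = sumBelow-0 n

sumBelow-+ : ∀ n (f g : ℕ → ℕ) → sumBelow n (λ k → f k + g k) ≡ sumBelow n f + sumBelow n g
sumBelow-+ zero    f g = refl
sumBelow-+ (suc n) f g = begin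
  f 0 + g 0 + sumBelow n (λ k → f′ k + g′ k)   ≡⟨ cong (f 0 + g 0 +_) (sumBelow-+ n f′ g′) ⟩
  f 0 + g 0 + (sumBelow n f′ + sumBelow n g′)  ≡⟨ +-interchange (f 0) (g 0) _ _ ⟩
  f 0 + sumBelow n f′ + (g 0 + sumBelow n g′)  ∎
  where
  f′ g′ : ℕ → ℕ
  f′ k = f (suc k)
  g′ k = g (suc k)
  +-interchange : ∀ a b c d → a + b + (c + d) ≡ a + c + (b + d)
  +-interchange = solve-∀

sumBelow-+₃ : ∀ n (f g h : ℕ → ℕ) →
              sumBelow n (λ k → f k + g k + h k) ≡ sumBelow n f + sumBelow n g + sumBelow n h
sumBelow-+₃ n f g h = trans (sumBelow-+ n (λ k → f k + g k) h) (cong (_+ sumBelow n h) (sumBelow-+ n f g))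

sumBelow-δ : ∀ n {k} → k < n → (f : ℕ → ℕ) → sumBelow n (λ t → [ t ≟ k ] * f t) ≡ f k
sumBelow-δ (suc n) {zero} _ f = begin
  1 * f 0 + sumBelow n (λ _ → 0) ≡⟨ cong (1 * f 0 +_) (sumBelow-0 n) ⟩
  1 * f 0 + 0                    ≡⟨ +-identityʳ _ ⟩
  1 * f 0                        ≡⟨ *-identityˡ (f 0) ⟩
  f 0                            ∎
sumBelow-δ (suc n) {suc k} (s≤s k<n) f = begin
  sumBelow n (λ t → [ suc t ≟ suc k ] * f (suc t)) ≡⟨ sumBelow-cong n (λ t _ → cong (_* f (suc t)) ([suc≟suc]≡[≟] t)) ⟩
  sumBelow n (λ t → [ t ≟ k ] * f (suc t))         ≡⟨ sumBelow-δ n k<n (λ t → f (suc t)) ⟩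
  f (suc k)                                        ∎
  where
  [suc≟suc]≡[≟] : ∀ t → [ suc t ≟ suc k ] ≡ [ t ≟ k ]
  [suc≟suc]≡[≟] t = []-cong (suc t ≟ suc k) (t ≟ k) suc-injective (cong suc)

sumBelow-unique : ∀ n {k} {P : ℕ → Set} (P? : ∀ t → Dec (P t)) → k < n → P k →
                  (∀ t → t < n → P t → t ≡ k) → (f : ℕ → ℕ) →
                  sumBelow n (λ t → [ P? t ] * f t) ≡ f k
sumBelow-unique n {k} P? k<n Pk unique f = begin
  sumBelow n (λ t → [ P? t ] * f t)  ≡⟨ sumBelow-cong n (λ t t<n → cong (_* f t) (P≡δ t t<n)) ⟩
  sumBelow n (λ t → [ t ≟ k ] * f t) ≡⟨ sumBelow-δ n k<n f ⟩
  f k                                ∎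
  where
  P≡δ : ∀ t → t < n → [ P? t ] ≡ [ t ≟ k ]
  P≡δ t t<n = []-cong (P? t) (t ≟ k) (unique t t<n) (λ { refl → Pk })

sumBelow-split : ∀ m n (f : ℕ → ℕ) → sumBelow (m + n) f ≡ sumBelow m f + sumBelow n (λ k → f (m + k))
sumBelow-split zero    n f = refl
sumBelow-split (suc m) n f = trans (cong (f 0 +_) (sumBelow-split m n (λ k → f (suc k)))) (sym (+-assoc (f 0) _ _))

sumBelow-mod : ∀ k m .{{_ : NonZero m}} (f : ℕ → ℕ) → sumBelow (k * m) (λ i → f (i % m)) ≡ k * sumBelow m f
sumBelow-mod zero    m f = refl
sumBelow-mod (suc k) m f = begin
  sumBelow (m + k * m) (λ i → f (i % m))                                     ≡⟨ sumBelow-split m (k * m) _ ⟩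
  sumBelow m (λ i → f (i % m)) + sumBelow (k * m) (λ i → f ((m + i) % m))    ≡⟨ cong₂ _+_ below-m shifted ⟩
  sumBelow m f + k * sumBelow m f                                            ∎
  where
  below-m : sumBelow m (λ i → f (i % m)) ≡ sumBelow m f
  below-m = sumBelow-cong m (λ i i<m → cong f (m<n⇒m%n≡m i<m))
  shifted : sumBelow (k * m) (λ i → f ((m + i) % m)) ≡ k * sumBelow m f
  shifted = trans (sumBelow-cong (k * m) (λ i _ → cong f (trans (cong (_% m) (+-comm m i)) ([m+n]%n≡m%n i m))))
                  (sumBelow-mod k m f)

[m*q+r]%m≡r : ∀ m .{{_ : NonZero m}} q {r} → r < m → (m * q + r) % m ≡ r
[m*q+r]%m≡r m q {r} r<m = begin
  (m * q + r) % m ≡⟨ cong (_% m) (trans (+-comm (m * q) r) (cong (r +_) (*-comm m q))) ⟩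
  (r + q * m) % m ≡⟨ [m+kn]%n≡m%n r q m ⟩
  r % m           ≡⟨ m<n⇒m%n≡m r<m ⟩
  r               ∎

m*q+r<m*n : ∀ m {q n r} → q < n → r < m → m * q + r < m * n
m*q+r<m*n m {q} {n} {r} q<n r<m =
  <-≤-trans (+-monoʳ-< (m * q) r<m) (subst (_≤ m * n) m*suc[q]≡m*q+m (*-monoʳ-≤ m q<n))
  where
  m*suc[q]≡m*q+m : m * suc q ≡ m * q + m
  m*suc[q]≡m*q+m = trans (*-suc m q) (+-comm m (m * q))

m∣n+[m∸n%m] : ∀ m .{{_ : NonZero m}} n → m ∣ n + (m ∸ n % m)
m∣n+[m∸n%m] m n = divides (suc (n / m)) (begin
  n + (m ∸ n % m)                   ≡⟨ cong (_+ (m ∸ n % m)) (m≡m%n+[m/n]*n n m) ⟩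
  n % m + n / m * m + (m ∸ n % m)   ≡⟨ cong (_+ (m ∸ n % m)) (+-comm (n % m) _) ⟩
  n / m * m + n % m + (m ∸ n % m)   ≡⟨ +-assoc (n / m * m) _ _ ⟩
  n / m * m + (n % m + (m ∸ n % m)) ≡⟨ cong (n / m * m +_) (m+[n∸m]≡n (<⇒≤ (m%n<n n m))) ⟩
  n / m * m + m                     ≡⟨ +-comm (n / m * m) m ⟩
  suc (n / m) * m                   ∎)

%-+-cong : ∀ {a b c d m} .{{_ : NonZero m}} → a % m ≡ b % m → c % m ≡ d % m → (a + c) % m ≡ (b + d) % m
%-+-cong {a} {b} {c} {d} {m} a≡b c≡d = begin
  (a + c) % m         ≡⟨ %-distribˡ-+ a c m ⟩
  (a % m + c % m) % m ≡⟨ cong₂ (λ u v → (u + v) % m) a≡b c≡d ⟩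
  (b % m + d % m) % m ≡⟨ %-distribˡ-+ b d m ⟨
  (b + d) % m         ∎

[a*[b%m]]%m≡[a*b]%m : ∀ a b m .{{_ : NonZero m}} → (a * (b % m)) % m ≡ (a * b) % m
[a*[b%m]]%m≡[a*b]%m a b m = begin
  (a * (b % m)) % m           ≡⟨ %-distribˡ-* a (b % m) m ⟩
  (a % m * (b % m % m)) % m   ≡⟨ cong (λ u → (a % m * u) % m) (m%n%n≡m%n b m) ⟩
  (a % m * (b % m)) % m       ≡⟨ %-distribˡ-* a b m ⟨
  (a * b) % m                 ∎

m∣n∧0<n∧n<m+m⇒n≡m : ∀ {m n} → m ∣ n → 0 < n → n < m + m → n ≡ m
m∣n∧0<n∧n<m+m⇒n≡m (divides zero refl) () _
m∣n∧0<n∧n<m+m⇒n≡m {m} (divides (suc zero) refl) _ _ = +-identityʳ m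
m∣n∧0<n∧n<m+m⇒n≡m {m} (divides (suc (suc k)) refl) _ n<m+m =
  ⊥-elim (<⇒≱ n<m+m (subst (m + m ≤_) (+-assoc m m (k * m)) (m≤m+n (m + m) (k * m))))

prev : ℕ → ℕ → ℕ
prev n zero    = n ∸ 1
prev n (suc j) = j

next : ℕ → ℕ → ℕ
next n i with suc i ≟ n
... | yes _ = 0
... | no  _ = suc i

prev< : ∀ {n j} → j < n → prev n j < n
prev< {suc n} {zero}  _     = n<1+n n
prev< {n}     {suc j} 1+j<n = <-trans (n<1+n j) 1+j<n

next< : ∀ {n i} → i < n → next n i < n
next< {n} {i} i<n with suc i ≟ n
... | yes _   = <-≤-trans z<s i<n
... | no 1+i≢n = ≤∧≢⇒< i<n 1+i≢n

prev-next : ∀ n i → prev n (next n i) ≡ i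
prev-next n i with suc i ≟ n
... | yes 1+i≡n = cong (_∸ 1) (sym 1+i≡n)
... | no  _     = refl

prev-injective : ∀ {n j k} → j < n → k < n → prev n j ≡ prev n k → j ≡ k
prev-injective {suc n} {zero}  {zero}  _     _     _   = refl
prev-injective {suc n} {zero}  {suc k} _     1+k<n n≡k = ⊥-elim (<-irrefl (sym n≡k) (s≤s⁻¹ 1+k<n))
prev-injective {suc n} {suc j} {zero}  1+j<n _     j≡n = ⊥-elim (<-irrefl j≡n (s≤s⁻¹ 1+j<n))
prev-injective {j = suc j} {suc k} _ _ j≡k = cong suc j≡k

prev-unique : ∀ {n i j} → i < n → j < n → i ≡ prev n j → j ≡ next n i
prev-unique {n} {i} i<n j<n i≡prev[j] = prev-injective j<n (next< i<n) (trans (sym i≡prev[j]) (sym (prev-next n i)))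

prev≢id : ∀ {n} → 2 ≤ n → ∀ j → prev n j ≢ j
prev≢id (s≤s (s≤s _)) zero    ()
prev≢id _              (suc j) j≡1+j = <-irrefl j≡1+j (n<1+n j)

prev²≢id : ∀ {n} → 3 ≤ n → ∀ j → prev n (prev n j) ≢ j
prev²≢id (s≤s (s≤s (s≤s _))) zero       ()
prev²≢id (s≤s (s≤s (s≤s _))) (suc zero) ()
prev²≢id _ (suc (suc j)) j≡2+j = <-irrefl j≡2+j (s≤s (n≤1+n j))

suc-prev≡[mod] : ∀ {n m} .{{_ : NonZero m}} → m ∣ n → ∀ {j} → j < n → suc (prev n j) % m ≡ j % m
suc-prev≡[mod] {suc n} {m} m∣n {zero}  _ = trans (n∣m⇒m%n≡0 (suc n) m m∣n) (sym (n∣m⇒m%n≡0 0 m (m ∣0)))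
suc-prev≡[mod]               _   {suc j} _ = refl

record PermutationBelow (n : ℕ) (f : ℕ → ℕ) : Set where
  field
    inverse   : ℕ → ℕ
    f<        : ∀ {t} → t < n → f t < n
    inverse<  : ∀ {t} → t < n → inverse t < n
    inverse∘f : ∀ {t} → t < n → inverse (f t) ≡ t
    f∘inverse : ∀ {t} → t < n → f (inverse t) ≡ t

id-permutation : ∀ {n} → PermutationBelow n (λ t → t)
id-permutation = record
  { inverse = λ t → t ; f< = λ t<n → t<n ; inverse< = λ t<n → t<n ; inverse∘f = λ _ → refl ; f∘inverse = λ _ → refl }

reflection-permutation : ∀ {n} → PermutationBelow n (λ t → n ∸ suc t)
reflection-permutation {n} = record
  { inverse = λ t → n ∸ suc t ; f< = reflect< ; inverse< = reflect< ; inverse∘f = reflect² ; f∘inverse = reflect² }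
  where
  reflect< : ∀ {t} → t < n → n ∸ suc t < n
  reflect< {t} (s≤s {n = m} _) = s≤s (m∸n≤m m t)
  reflect² : ∀ {t} → t < n → n ∸ suc (n ∸ suc t) ≡ t
  reflect² (s≤s t≤m) = m∸[m∸n]≡n t≤m

∘-permutation : ∀ {n f g} → PermutationBelow n f → PermutationBelow n g → PermutationBelow n (λ t → g (f t))
∘-permutation {f = f} {g} F G = record
  { inverse   = λ t → F.inverse (G.inverse t)
  ; f<        = λ t<n → G.f< (F.f< t<n)
  ; inverse<  = λ t<n → F.inverse< (G.inverse< t<n)
  ; inverse∘f = λ t<n → trans (cong F.inverse (G.inverse∘f (F.f< t<n))) (F.inverse∘f t<n)
  ; f∘inverse = λ t<n → trans (cong g (F.f∘inverse (G.inverse< t<n))) (G.f∘inverse t<n)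
  }
  where
  module F = PermutationBelow F
  module G = PermutationBelow G

-- The inverse of doubling modulo 2h + 1 is multiplication by h + 1, since 2(h + 1) ≡ 1.
doubling-permutation : ∀ h → PermutationBelow (suc (h + h)) (λ t → (t + t) % suc (h + h))
doubling-permutation h = record
  { inverse   = halve
  ; f<        = λ {t} _ → m%n<n (t + t) τ
  ; inverse<  = λ {t} _ → m%n<n (suc h * t) τ
  ; inverse∘f = halve∘double
  ; f∘inverse = double∘halve
  }
  where
  τ : ℕ
  τ = suc (h + h)
  halve : ℕ → ℕ
  halve q = (suc h * q) % τ
  [1+h][t+t]≡t+tτ : ∀ h t → suc h * (t + t) ≡ t + t * suc (h + h)
  [1+h][t+t]≡t+tτ = solve-∀
  [1+h]t+[1+h]t≡t+tτ : ∀ h t → suc h * t + suc h * t ≡ t + t * suc (h + h)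
  [1+h]t+[1+h]t≡t+tτ = solve-∀
  halve∘double : ∀ {t} → t < τ → halve ((t + t) % τ) ≡ t
  halve∘double {t} t<τ = begin
    (suc h * ((t + t) % τ)) % τ ≡⟨ [a*[b%m]]%m≡[a*b]%m (suc h) (t + t) τ ⟩
    (suc h * (t + t)) % τ       ≡⟨ cong (_% τ) ([1+h][t+t]≡t+tτ h t) ⟩
    (t + t * τ) % τ             ≡⟨ [m+kn]%n≡m%n t t τ ⟩
    t % τ                       ≡⟨ m<n⇒m%n≡m t<τ ⟩
    t                           ∎
  double∘halve : ∀ {q} → q < τ → (halve q + halve q) % τ ≡ q
  double∘halve {q} q<τ = begin
    (halve q + halve q) % τ         ≡⟨ %-distribˡ-+ (suc h * q) (suc h * q) τ ⟨
    (suc h * q + suc h * q) % τ     ≡⟨ cong (_% τ) ([1+h]t+[1+h]t≡t+tτ h q) ⟩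
    (q + q * τ) % τ                 ≡⟨ [m+kn]%n≡m%n q q τ ⟩
    q % τ                           ≡⟨ m<n⇒m%n≡m q<τ ⟩
    q                               ∎

count-residue : ∀ m {n g} .{{_ : NonZero m}} → PermutationBelow n g → ∀ {r X} → r < m → X < m * n →
                sumBelow n (λ t → [ m * g t + r ≟ X ]) ≡ [ X % m ≟ r ]
count-residue m {n} {g} G {r} {X} r<m X<mn with X % m ≟ r
... | no X%m≢r = trans (sumBelow-cong n (λ t _ → []-no (m * g t + r ≟ X) (miss t))) (sumBelow-0 n)
  where
  miss : ∀ t → m * g t + r ≢ X
  miss t e = X%m≢r (trans (cong (_% m) (sym e)) ([m*q+r]%m≡r m (g t) r<m))
... | yes X%m≡r = begin
  sumBelow n (λ t → [ m * g t + r ≟ X ])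
    ≡⟨ sumBelow-cong n (λ t _ → sym (*-identityʳ _)) ⟩
  sumBelow n (λ t → [ m * g t + r ≟ X ] * 1)
    ≡⟨ sumBelow-unique n (λ t → m * g t + r ≟ X) (inverse< q<n) hit unique (λ _ → 1) ⟩
  1 ∎
  where
  open PermutationBelow G
  q : ℕ
  q = X / m
  q<n : q < n
  q<n = m<n*o⇒m/o<n (subst (X <_) (*-comm m n) X<mn)
  m*q+r≡X : m * q + r ≡ X
  m*q+r≡X = begin
    m * q + r     ≡⟨ cong₂ _+_ (*-comm m q) (sym X%m≡r) ⟩
    q * m + X % m ≡⟨ +-comm (q * m) (X % m) ⟩
    X % m + q * m ≡⟨ m≡m%n+[m/n]*n X m ⟨
    X             ∎
  hit : m * g (inverse q) + r ≡ X
  hit = trans (cong (λ u → m * u + r) (f∘inverse q<n)) m*q+r≡X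
  unique : ∀ t → t < n → m * g t + r ≡ X → t ≡ inverse q
  unique t t<n e = trans (sym (inverse∘f t<n)) (cong inverse g[t]≡q)
    where
    g[t]≡q : g t ≡ q
    g[t]≡q = *-cancelˡ-≡ (g t) q m (+-cancelʳ-≡ r _ _ (trans e (sym m*q+r≡X)))

pmCount-just : ∀ {w} (x e : Fin w) {v y} → toℕ e ≡ v → 0 < v → v + y ≡ w →
               pmCount x (just e) ≡ [ v ≟ toℕ x ] + [ y ≟ toℕ x ]
pmCount-just {w} x e {v} {y} e≡v 0<v v+y≡w = cong₂ _+_
  ([]-cong (e ≟ᶠ x) (v ≟ toℕ x) (λ e≡x → trans (sym e≡v) (cong toℕ e≡x))
                                 (λ v≡x → toℕ-injective (trans e≡v v≡x)))
  ([]-cong (w ∣? (toℕ e + toℕ x)) (y ≟ toℕ x) negation⇒ ⇒negation)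
  where
  v≤w : v ≤ w
  v≤w = subst (v ≤_) v+y≡w (m≤m+n v y)
  negation⇒ : w ∣ toℕ e + toℕ x → y ≡ toℕ x
  negation⇒ w∣e+x = +-cancelˡ-≡ v y (toℕ x) (trans v+y≡w (sym (m∣n∧0<n∧n<m+m⇒n≡m w∣v+x 0<v+x v+x<w+w)))
    where
    w∣v+x : w ∣ v + toℕ x
    w∣v+x = subst (λ u → w ∣ u + toℕ x) e≡v w∣e+x
    0<v+x : 0 < v + toℕ x
    0<v+x = <-≤-trans 0<v (m≤m+n v (toℕ x))
    v+x<w+w : v + toℕ x < w + w
    v+x<w+w = +-mono-≤-< v≤w (toℕ<n x)
  ⇒negation : y ≡ toℕ x → w ∣ toℕ e + toℕ x
  ⇒negation y≡x = subst (w ∣_) (sym (trans (cong₂ _+_ e≡v (sym y≡x)) v+y≡w)) ∣-refl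

first₃ : {A P Q R : Set} → Dec P → Dec Q → Dec R → A → A → A → Maybe A
first₃ (yes _) _       _       a _ _ = just a
first₃ (no _)  (yes _) _       _ b _ = just b
first₃ (no _)  (no _)  (yes _) _ _ c = just c
first₃ (no _)  (no _)  (no _)  _ _ _ = nothing

first₃-split : ∀ {A P Q R : Set} (g : Maybe A → ℕ) → g nothing ≡ 0 →
               (P? : Dec P) (Q? : Dec Q) (R? : Dec R) → (P → ¬ Q) → (P → ¬ R) → (Q → ¬ R) → ∀ a b c →
               g (first₃ P? Q? R? a b c) ≡ [ P? ] * g (just a) + [ Q? ] * g (just b) + [ R? ] * g (just c)
first₃-split _ _  (yes p) (yes q) _       P⇒¬Q _    _    _ _ _ = ⊥-elim (P⇒¬Q p q)
first₃-split _ _  (yes p) (no _)  (yes r) _    P⇒¬R _    _ _ _ = ⊥-elim (P⇒¬R p r)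
first₃-split _ _  (yes _) (no _)  (no _)  _    _    _    _ _ _ = sym (trans (+-identityʳ _) (trans (+-identityʳ _) (*-identityˡ _)))
first₃-split _ _  (no _)  (yes q) (yes r) _    _    Q⇒¬R _ _ _ = ⊥-elim (Q⇒¬R q r)
first₃-split _ _  (no _)  (yes _) (no _)  _    _    _    _ _ _ = sym (trans (+-identityʳ _) (*-identityˡ _))
first₃-split _ _  (no _)  (no _)  (yes _) _    _    _    _ _ _ = sym (*-identityˡ _)
first₃-split _ g0 (no _)  (no _)  (no _)  _    _    _    _ _ _ = g0

pmResidueCount : ℕ → ℕ
pmResidueCount r = ([ r ≟ 1 ] + [ r ≟ 6 ]) + ([ r ≟ 2 ] + [ r ≟ 5 ]) + ([ r ≟ 4 ] + [ r ≟ 3 ])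

pmResidueCount-nonzero : ∀ r → r < 7 → r ≢ 0 → pmResidueCount r ≡ 1
pmResidueCount-nonzero zero _ r≢0 = ⊥-elim (r≢0 refl)
pmResidueCount-nonzero 1 _ _ = refl
pmResidueCount-nonzero 2 _ _ = refl
pmResidueCount-nonzero 3 _ _ = refl
pmResidueCount-nonzero 4 _ _ = refl
pmResidueCount-nonzero 5 _ _ = refl
pmResidueCount-nonzero 6 _ _ = refl
pmResidueCount-nonzero (suc (suc (suc (suc (suc (suc (suc _))))))) (s≤s (s≤s (s≤s (s≤s (s≤s (s≤s (s≤s ()))))))) _

module Construction (h lam n : ℕ) (n≡lam*τ : n ≡ lam * suc (h + h)) (3≤n : 3 ≤ n) where

  τ w : ℕ
  τ = suc (h + h)
  w = 7 * τ

  rev dbl : ℕ → ℕ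
  rev t = τ ∸ suc t
  dbl t = (t + t) % τ

  module Rev = PermutationBelow (reflection-permutation {τ})
  module Dbl = PermutationBelow (doubling-permutation h)

  entry : (t r : ℕ) → t < τ → r < 7 → Fin w
  entry t r t<τ r<7 = fromℕ< (m*q+r<m*n 7 t<τ r<7)

  A B C : ℕ → Fin w
  A i = entry (i % τ) 1 (m%n<n i τ) (<ᵇ⇒< 1 7 _)
  B i = entry (i % τ) 2 (m%n<n i τ) (<ᵇ⇒< 2 7 _)
  C i = entry (rev (dbl (i % τ))) 4 (Rev.f< (Dbl.f< (m%n<n i τ))) (<ᵇ⇒< 4 7 _)

  toℕ-A : ∀ i → toℕ (A i) ≡ 7 * (i % τ) + 1
  toℕ-A i = toℕ-fromℕ< _

  toℕ-B : ∀ i → toℕ (B i) ≡ 7 * (i % τ) + 2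
  toℕ-B i = toℕ-fromℕ< _

  toℕ-C : ∀ i → toℕ (C i) ≡ 7 * rev (dbl (i % τ)) + 4
  toℕ-C i = toℕ-fromℕ< _

  cell : ℕ → ℕ → Maybe (Fin w)
  cell i j = first₃ (i ≟ j) (i ≟ prev n (prev n j)) (i ≟ prev n j) (A i) (B i) (C i)

  cell-split : (g : Maybe (Fin w) → ℕ) → g nothing ≡ 0 → ∀ i j →
               g (cell i j) ≡ [ i ≟ j ] * g (just (A i)) + [ i ≟ prev n (prev n j) ] * g (just (B i))
                              + [ i ≟ prev n j ] * g (just (C i))
  cell-split g g0 i j = first₃-split g g0 _ _ _
    (λ i≡j i≡p²j → prev²≢id 3≤n j (trans (sym i≡p²j) i≡j))
    (λ i≡j i≡pj → prev≢id 2≤n j (trans (sym i≡pj) i≡j))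
    (λ i≡p²j i≡pj → prev≢id 2≤n (prev n j) (trans (sym i≡p²j) i≡pj))
    (A i) (B i) (C i)
    where
    2≤n : 2 ≤ n
    2≤n = ≤-trans (n≤1+n 2) 3≤n

  row-sum : (g : Maybe (Fin w) → ℕ) → g nothing ≡ 0 → ∀ {i} → i < n →
            sumBelow n (λ j → g (cell i j)) ≡ g (just (A i)) + g (just (B i)) + g (just (C i))
  row-sum g g0 {i} i<n = begin
    sumBelow n (λ j → g (cell i j))
      ≡⟨ sumBelow-cong n (λ j _ → cell-split g g0 i j) ⟩
    sumBelow n (λ j → [ i ≟ j ] * a + [ i ≟ prev n (prev n j) ] * b + [ i ≟ prev n j ] * c)
      ≡⟨ sumBelow-+₃ n (λ j → [ i ≟ j ] * a) (λ j → [ i ≟ prev n (prev n j) ] * b) (λ j → [ i ≟ prev n j ] * c) ⟩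
    sumBelow n (λ j → [ i ≟ j ] * a) + sumBelow n (λ j → [ i ≟ prev n (prev n j) ] * b)
      + sumBelow n (λ j → [ i ≟ prev n j ] * c)
      ≡⟨ cong₂ _+_ (cong₂ _+_ at-i at-next²) at-next ⟩
    a + b + c ∎
    where
    a b c : ℕ
    a = g (just (A i))
    b = g (just (B i))
    c = g (just (C i))
    at-i : sumBelow n (λ j → [ i ≟ j ] * a) ≡ a
    at-i = sumBelow-unique n (λ j → i ≟ j) i<n refl (λ _ _ i≡j → sym i≡j) (λ _ → a)
    at-next : sumBelow n (λ j → [ i ≟ prev n j ] * c) ≡ c
    at-next = sumBelow-unique n (λ j → i ≟ prev n j) (next< i<n) (sym (prev-next n i))
                (λ _ j<n → prev-unique i<n j<n) (λ _ → c)
    at-next² : sumBelow n (λ j → [ i ≟ prev n (prev n j) ] * b) ≡ b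
    at-next² = sumBelow-unique n (λ j → i ≟ prev n (prev n j)) (next< (next< i<n))
                 (sym (trans (cong (prev n) (prev-next n (next n i))) (prev-next n i)))
                 (λ j j<n e → prev-unique (next< i<n) j<n (sym (prev-unique i<n (prev< j<n) e))) (λ _ → b)

  column-sum : (g : Maybe (Fin w) → ℕ) → g nothing ≡ 0 → ∀ {j} → j < n →
               sumBelow n (λ i → g (cell i j))
                 ≡ g (just (A j)) + g (just (B (prev n (prev n j)))) + g (just (C (prev n j)))
  column-sum g g0 {j} j<n = begin
    sumBelow n (λ i → g (cell i j))
      ≡⟨ sumBelow-cong n (λ i _ → cell-split g g0 i j) ⟩
    sumBelow n (λ i → [ i ≟ j ] * a i + [ i ≟ prev n (prev n j) ] * b i + [ i ≟ prev n j ] * c i)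
      ≡⟨ sumBelow-+₃ n (λ i → [ i ≟ j ] * a i) (λ i → [ i ≟ prev n (prev n j) ] * b i)
                       (λ i → [ i ≟ prev n j ] * c i) ⟩
    sumBelow n (λ i → [ i ≟ j ] * a i) + sumBelow n (λ i → [ i ≟ prev n (prev n j) ] * b i)
      + sumBelow n (λ i → [ i ≟ prev n j ] * c i)
      ≡⟨ cong₂ _+_ (cong₂ _+_ (sumBelow-δ n j<n a) (sumBelow-δ n (prev< (prev< j<n)) b)) (sumBelow-δ n (prev< j<n) c) ⟩
    a j + b (prev n (prev n j)) + c (prev n j) ∎
    where
    a b c : ℕ → ℕ
    a i = g (just (A i))
    b i = g (just (B i))
    c i = g (just (C i))

  entries-divisible : ∀ a b c → (a % τ + b % τ) % τ ≡ dbl (c % τ) → w ∣ toℕ (A a) + toℕ (B b) + toℕ (C c)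
  entries-divisible a b c classes = subst (w ∣_) (sym entries≡) (*-monoʳ-∣ 7 (m∣n+[m∸n%m] τ s))
    where
    s d : ℕ
    s = a % τ + b % τ
    d = dbl (c % τ)
    digits : ∀ x y z → 7 * x + 1 + (7 * y + 2) + (7 * z + 4) ≡ 7 * (x + y + suc z)
    digits = solve-∀
    entries≡ : toℕ (A a) + toℕ (B b) + toℕ (C c) ≡ 7 * (s + (τ ∸ s % τ))
    entries≡ = begin
      toℕ (A a) + toℕ (B b) + toℕ (C c)
        ≡⟨ cong₂ _+_ (cong₂ _+_ (toℕ-A a) (toℕ-B b)) (toℕ-C c) ⟩
      7 * (a % τ) + 1 + (7 * (b % τ) + 2) + (7 * rev d + 4) ≡⟨ digits (a % τ) (b % τ) (rev d) ⟩
      7 * (s + suc (rev d))                                   ≡⟨ cong (λ u → 7 * (s + u)) (+-∸-assoc 1 (Dbl.f< (m%n<n c τ))) ⟨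
      7 * (s + (τ ∸ d))                                       ≡⟨ cong (λ u → 7 * (s + (τ ∸ u))) classes ⟨
      7 * (s + (τ ∸ s % τ))                                   ∎

  column-classes : ∀ {j} → j < n → (j % τ + prev n (prev n j) % τ) % τ ≡ dbl (prev n j % τ)
  column-classes {j} j<n = begin
    (j % τ + p² % τ) % τ ≡⟨ %-distribˡ-+ j p² τ ⟨
    (j + p²) % τ         ≡⟨ %-+-cong {j} {suc p} {p²} {p²} (sym (suc-prev≡[mod] τ∣n j<n)) refl ⟩
    (suc p + p²) % τ     ≡⟨ cong (_% τ) (+-suc p p²) ⟨
    (p + suc p²) % τ     ≡⟨ %-+-cong {p} {p} {suc p²} {p} refl (suc-prev≡[mod] τ∣n (prev< j<n)) ⟩
    (p + p) % τ          ≡⟨ %-distribˡ-+ p p τ ⟩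
    dbl (p % τ)          ∎
    where
    p p² : ℕ
    p  = prev n j
    p² = prev n p
    τ∣n : τ ∣ n
    τ∣n = divides lam n≡lam*τ

  entry+negation≡w : ∀ {t r s} → t < τ → r + s ≡ 7 → 7 * t + r + (7 * rev t + s) ≡ w
  entry+negation≡w {t} {r} {s} t<τ r+s≡7 = begin
    7 * t + r + (7 * rev t + s)  ≡⟨ regroup t (rev t) r s ⟩
    7 * (t + rev t) + (r + s)    ≡⟨ cong (7 * (t + rev t) +_) r+s≡7 ⟩
    7 * (t + rev t) + 7          ≡⟨ trans (*-suc 7 (t + rev t)) (+-comm 7 _) ⟨
    7 * suc (t + rev t)          ≡⟨ cong (7 *_) (m+[n∸m]≡n t<τ) ⟩
    w                            ∎
    where
    regroup : ∀ a d r s → 7 * a + r + (7 * d + s) ≡ 7 * (a + d) + (r + s)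
    regroup = solve-∀

  pmCount-entry : ∀ x {t r s} (t<τ : t < τ) (r<7 : r < 7) → 0 < r → r + s ≡ 7 →
                  pmCount x (just (entry t r t<τ r<7)) ≡ [ 7 * t + r ≟ toℕ x ] + [ 7 * rev t + s ≟ toℕ x ]
  pmCount-entry x {t} {r} t<τ r<7 0<r r+s≡7 =
    pmCount-just x _ (toℕ-fromℕ< _) (<-≤-trans 0<r (m≤n+m r (7 * t))) (entry+negation≡w t<τ r+s≡7)

  classCount : ℕ → ℕ → ℕ
  classCount X t = ([ 7 * t + 1 ≟ X ] + [ 7 * rev t + 6 ≟ X ])
                 + ([ 7 * t + 2 ≟ X ] + [ 7 * rev t + 5 ≟ X ])
                 + ([ 7 * rev (dbl t) + 4 ≟ X ] + [ 7 * dbl t + 3 ≟ X ])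

  pmCount-row : ∀ x i → pmCount x (just (A i)) + pmCount x (just (B i)) + pmCount x (just (C i))
                        ≡ classCount (toℕ x) (i % τ)
  pmCount-row x i = cong₂ _+_
    (cong₂ _+_ (pmCount-entry x {s = 6} t<τ (<ᵇ⇒< 1 7 _) z<s refl) (pmCount-entry x {s = 5} t<τ (<ᵇ⇒< 2 7 _) z<s refl))
    (trans (pmCount-entry x {s = 3} (Rev.f< d<τ) (<ᵇ⇒< 4 7 _) z<s refl)
           (cong (λ u → [ 7 * rev d + 4 ≟ toℕ x ] + [ 7 * u + 3 ≟ toℕ x ]) (Rev.inverse∘f d<τ)))
    where
    d : ℕ
    d = dbl (i % τ)
    t<τ : i % τ < τ
    t<τ = m%n<n i τ
    d<τ : d < τ
    d<τ = Dbl.f< t<τ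

  sumBelow-classCount : ∀ {X} → X < w → sumBelow τ (classCount X) ≡ pmResidueCount (X % 7)
  sumBelow-classCount {X} X<w = begin
    sumBelow τ (classCount X)
      ≡⟨ sumBelow-+₃ τ (λ t → [ 7 * t + 1 ≟ X ] + [ 7 * rev t + 6 ≟ X ])
                       (λ t → [ 7 * t + 2 ≟ X ] + [ 7 * rev t + 5 ≟ X ])
                       (λ t → [ 7 * rev (dbl t) + 4 ≟ X ] + [ 7 * dbl t + 3 ≟ X ]) ⟩
    sumBelow τ (λ t → [ 7 * t + 1 ≟ X ] + [ 7 * rev t + 6 ≟ X ])
      + sumBelow τ (λ t → [ 7 * t + 2 ≟ X ] + [ 7 * rev t + 5 ≟ X ])
      + sumBelow τ (λ t → [ 7 * rev (dbl t) + 4 ≟ X ] + [ 7 * dbl t + 3 ≟ X ])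
      ≡⟨ cong₂ _+_ (cong₂ _+_ (pair id-permutation reflection-permutation (<ᵇ⇒< 1 7 _) (<ᵇ⇒< 6 7 _))
                              (pair id-permutation reflection-permutation (<ᵇ⇒< 2 7 _) (<ᵇ⇒< 5 7 _)))
                   (pair (∘-permutation (doubling-permutation h) reflection-permutation) (doubling-permutation h)
                         (<ᵇ⇒< 4 7 _) (<ᵇ⇒< 3 7 _)) ⟩
    pmResidueCount (X % 7) ∎
    where
    pair : ∀ {f g} → PermutationBelow τ f → PermutationBelow τ g → ∀ {r s} → r < 7 → s < 7 →
           sumBelow τ (λ t → [ 7 * f t + r ≟ X ] + [ 7 * g t + s ≟ X ]) ≡ [ X % 7 ≟ r ] + [ X % 7 ≟ s ]
    pair {f} {g} F G {r} {s} r<7 s<7 =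
      trans (sumBelow-+ τ (λ t → [ 7 * f t + r ≟ X ]) (λ t → [ 7 * g t + s ≟ X ]))
            (cong₂ _+_ (count-residue 7 F r<7 X<w) (count-residue 7 G s<7 X<w))

  array : PFArray n w
  array i j = cell (toℕ i) (toℕ j)

  pmCount-total : ∀ x → Σ[< n ] (λ i → Σ[< n ] (λ j → pmCount x (array i j))) ≡ lam * pmResidueCount (toℕ x % 7)
  pmCount-total x = begin
    Σ[< n ] (λ i → Σ[< n ] (λ j → pmCount x (cell (toℕ i) (toℕ j))))
      ≡⟨ Σ[<]-toℕ n (λ i → Σ[< n ] (λ j → pmCount x (cell i (toℕ j)))) ⟩
    sumBelow n (λ i → Σ[< n ] (λ j → pmCount x (cell i (toℕ j))))
      ≡⟨ sumBelow-cong n (λ i i<n → trans (Σ[<]-toℕ n (λ j → pmCount x (cell i j)))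
                                          (trans (row-sum (pmCount x) refl i<n) (pmCount-row x i))) ⟩
    sumBelow n (λ i → classCount (toℕ x) (i % τ))
      ≡⟨ cong (λ m → sumBelow m (λ i → classCount (toℕ x) (i % τ))) n≡lam*τ ⟩
    sumBelow (lam * τ) (λ i → classCount (toℕ x) (i % τ))
      ≡⟨ sumBelow-mod lam τ (classCount (toℕ x)) ⟩
    lam * sumBelow τ (classCount (toℕ x))
      ≡⟨ cong (lam *_) (sumBelow-classCount (toℕ<n x)) ⟩
    lam * pmResidueCount (toℕ x % 7) ∎

  pmResidueCount-∉J : ∀ x → ¬ InJ w τ x → pmResidueCount (toℕ x % 7) ≡ 1
  pmResidueCount-∉J x x∉J =
    pmResidueCount-nonzero _ (m%n<n (toℕ x) 7) (λ x%7≡0 → x∉J (7∣⇒InJ (m%n≡0⇒n∣m _ 7 x%7≡0)))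
    where
    7∣⇒InJ : 7 ∣ toℕ x → InJ w τ x
    7∣⇒InJ 7∣x = subst (_∣ τ * toℕ x) (*-comm τ 7) (*-monoʳ-∣ τ 7∣x)

  pmResidueCount-∈J : ∀ x → InJ w τ x → pmResidueCount (toℕ x % 7) ≡ 0
  pmResidueCount-∈J x w∣τx = cong pmResidueCount (n∣m⇒m%n≡0 _ 7 7∣x)
    where
    7∣x : 7 ∣ toℕ x
    7∣x = *-cancelˡ-∣ τ (subst (_∣ τ * toℕ x) (*-comm 7 τ) w∣τx)

  row-divisible : ∀ {i} → i < n → w ∣ sumBelow n (λ j → val (cell i j))
  row-divisible {i} i<n = subst (w ∣_) (sym (row-sum val refl i<n)) (entries-divisible i i i refl)

  column-divisible : ∀ {j} → j < n → w ∣ sumBelow n (λ i → val (cell i j))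
  column-divisible {j} j<n =
    subst (w ∣_) (sym (column-sum val refl j<n)) (entries-divisible j (prev n (prev n j)) (prev n j) (column-classes j<n))

  isH : IsH lam τ n w array
  isH = record
    { rowFilled = λ i → trans (Σ[<]-toℕ n (λ j → filled (cell (toℕ i) j))) (row-sum filled refl (toℕ<n i))
    ; colFilled = λ j → trans (Σ[<]-toℕ n (λ i → filled (cell i (toℕ j)))) (column-sum filled refl (toℕ<n j))
    ; multOutJ  = λ x x∉J → trans (pmCount-total x) (trans (cong (lam *_) (pmResidueCount-∉J x x∉J)) (*-identityʳ lam))
    ; multInJ   = λ x x∈J → trans (pmCount-total x) (trans (cong (lam *_) (pmResidueCount-∈J x x∈J)) (*-zeroʳ lam))
    ; rowSum    = λ i → subst (w ∣_) (sym (Σ[<]-toℕ n (λ j → val (cell (toℕ i) j)))) (row-divisible (toℕ<n i))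
    ; colSum    = λ j → subst (w ∣_) (sym (Σ[<]-toℕ n (λ i → val (cell i (toℕ j))))) (column-divisible (toℕ<n j))
    }

odd⇒≡1+h+h : ∀ q → ¬ 2 ∣ q → Σ ℕ (λ h → q ≡ suc (h + h))
odd⇒≡1+h+h zero          2∤0   = ⊥-elim (2∤0 (2 ∣0))
odd⇒≡1+h+h (suc zero)    _     = 0 , refl
odd⇒≡1+h+h (suc (suc q)) 2∤2+q with odd⇒≡1+h+h q (λ 2∣q → 2∤2+q (∣m∣n⇒∣m+n ∣-refl 2∣q))
... | h , refl = suc h , cong (λ u → suc (suc u)) (sym (+-suc h h))

modulus-on-multiple : ∀ lam q {n} .{{_ : NonZero lam}} → n ≡ q * lam →
                      n / lam ≡ q × modulus lam (n / lam) n ≡ 7 * q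
modulus-on-multiple lam q {n} n≡q*lam = n/lam≡q , (begin
  (6 * n) / lam + n / lam ≡⟨ cong₂ _+_ (trans (cong (_/ lam) 6n≡6q*lam) (m*n/n≡m (6 * q) lam)) n/lam≡q ⟩
  6 * q + q               ≡⟨ +-comm (6 * q) q ⟩
  7 * q                   ∎)
  where
  n/lam≡q : n / lam ≡ q
  n/lam≡q = trans (cong (_/ lam) n≡q*lam) (m*n/n≡m q lam)
  6n≡6q*lam : 6 * n ≡ 6 * q * lam
  6n≡6q*lam = trans (cong (6 *_) n≡q*lam) (sym (*-assoc 6 q lam))

proposition4p14 : (n lam : ℕ) .{{_ : NonZero lam}} → 3 ≤ n → ¬ (2 ∣ n) → lam ∣ n
                  → HArray lam (n / lam) n
proposition4p14 n lam 3≤n 2∤n (divides q n≡q*lam)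
  with odd⇒≡1+h+h q (λ 2∣q → 2∤n (subst (2 ∣_) (sym n≡q*lam) (∣m⇒∣m*n lam 2∣q)))
... | h , refl =
  let n/lam≡τ , modulus≡7τ = modulus-on-multiple lam q n≡q*lam
      open Construction h lam n (trans n≡q*lam (*-comm q lam)) 3≤n
  in  subst₂ (λ τ w → Σ (PFArray n w) (IsH lam τ n w)) (sym n/lam≡τ) (sym modulus≡7τ) (array , isH)
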